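{- The following are equivalent: (1) for every positive integer $n$ and every system $S\subseteq E_n$ which has only finitely many solutions in integers $x_1,\ldots,x_n$, each such solution satisfies $|x_1|,\ldots,|x_n|\le 2^{2^{n-1}}$; (2) for every positive integer $n$ the statement $\Lambda_n$ holds, where $\Lambda_n$ is: for all $x_1,\ldots,x_n\in\mathbb{Z}$ there exist $y_1,\ldots,y_n\in\mathbb{Z}$ such that $\bigl(2^{2^{n-1}}<|x_1|\Rightarrow(|x_1|<|y_1|\vee\ldots\vee|x_1|<|y_n|)\bigr)$, and for all $i,j,k\in\{1,\ldots,n\}$ ($x_i+x_j=x_k\Rightarrow y_i+y_j=y_k$), and for all $i,j,k\in\{1,\ldots,n\}$ ($x_i\cdot x_j=x_k\Rightarrow y_i\cdot y_j=y_k$).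
   Context: For a positive integer $n$, $E_n=\{x_i=1,\ x_i+x_j=x_k,\ x_i\cdot x_j=x_k:\ i,j,k\in\{1,\ldots,n\}\}$; a system $S\subseteq E_n$ is a set of such equations in the variables $x_1,\ldots,x_n$. -}

module Defs where

open import Data.Nat using (ℕ; suc; _^_; _≤_; _<_)
open import Data.Integer using (ℤ; _+_; _*_; +_; ∣_∣)
open import Data.Fin using (Fin; zero)
open import Data.List using (List)
open import Data.List.Relation.Unary.Any using (Any)
open import Data.Product using (Σ; _×_)
open import Relation.Binary.PropositionalEquality using (_≡_)

-- The equations of E_n, in the variables x_1..x_n (indexed by Fin n).
data Equation (n : ℕ) : Set where
  one : Fin n → Equation n
  add : Fin n → Fin n → Fin n → Equation n
  mul : Fin n → Fin n → Fin n → Equation n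

Holds : ∀ {n} → (Fin n → ℤ) → Equation n → Set
Holds x (one i)     = x i ≡ + 1
Holds x (add i j k) = x i + x j ≡ x k
Holds x (mul i j k) = x i * x j ≡ x k

System : ℕ → Set₁
System n = Equation n → Set

Solution : ∀ {n} → System n → (Fin n → ℤ) → Set
Solution S x = ∀ e → S e → Holds x e

FinitelyManySolutions : ∀ {n} → System n → Set
FinitelyManySolutions {n} S =
  Σ (List (Fin n → ℤ)) λ L → (∀ (x : Fin n → ℤ) → Solution S x →
            Any (λ y → ∀ i → x i ≡ y i) L)

-- The bound 2^(2^(n-1)) for n = suc m.
bound : ℕ → ℕ
bound m = 2 ^ (2 ^ m)

Statement1 : Set₁
Statement1 = ∀ (m : ℕ) (S : System (suc m)) → FinitelyManySolutions S →
  ∀ (x : Fin (suc m) → ℤ) → Solution S x → ∀ i → ∣ x i ∣ ≤ bound m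

-- Λ_n for n = suc m (x_1 is index zero).
Λ : ℕ → Set
Λ m = ∀ (x : Fin (suc m) → ℤ) → Σ (Fin (suc m) → ℤ) λ y →
  ( (bound m < ∣ x zero ∣ → Σ (Fin (suc m)) λ i → (∣ x zero ∣ < ∣ y i ∣))
  × (∀ (i j k : Fin (suc m)) → x i + x j ≡ x k → y i + y j ≡ y k)
  × (∀ (i j k : Fin (suc m)) → x i * x j ≡ x k → y i * y j ≡ y k) )

Statement2 : Set
Statement2 = ∀ (m : ℕ) → Λ m

module Submission where

-- Call y a *relational image* of x when every relation
-- x_i + x_j = x_k and x_i · x_j = x_k also holds for y.  A relational image
-- with some nonzero coordinate also preserves x_i = 1 (from 1 · x_j = x_j
-- one cancels y_j), hence solves every system that x solves; conversely the
-- solutions of the system of all equations satisfied by x are exactly the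
-- relational images of x that have x's ones.
--
-- (2) ⇒ (1): Λ_m, after a transposition of coordinates, turns any solution
-- with a coordinate above 2^(2^m) into a solution with a strictly larger
-- coordinate.  Iterating gives solutions with arbitrarily large coordinates,
-- which no finite list of solutions can cover, since a finite list is bounded.
--
-- (1) ⇒ (2) (classically): given x with |x_1| > 2^(2^m), let S be the set of
-- all equations x satisfies.  If some solution of S has a coordinate larger
-- than |x_1| it is the required y.  Otherwise all solutions of S lie in the
-- box [-|x_1|, |x_1|]^n, which is finite, so (1) bounds |x_1| — contradiction.

open import Defs
open import Level using (0ℓ)
open import Axiom.ExcludedMiddle using (ExcludedMiddle)
open import Data.Product using (_×_; Σ; _,_)
open import Data.Nat as ℕ using (ℕ; zero; suc; _≤_; _<_; s≤s)
import Data.Nat.Properties as ℕP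
open import Data.Integer as ℤ using (ℤ; +_; -[1+_]; ∣_∣)
import Data.Integer.Properties as ℤP
open import Data.Fin using (Fin) renaming (zero to fz; suc to fs)
open import Data.Fin.Permutation.Components using (transpose; transpose-inverse)
open import Data.Vec.Functional using (Vector) renaming (_∷_ to _◂_)
open import Data.List using (List; []; _∷_; map; _++_; upTo; cartesianProductWith)
open import Data.List.Relation.Unary.Any using (Any; here; there)
open import Data.List.Membership.Propositional using (_∈_; find; lose)
open import Data.List.Membership.Propositional.Properties
  using (∈-++⁺ˡ; ∈-++⁺ʳ; ∈-map⁺; ∈-upTo⁺; ∈-cartesianProductWith⁺)
open import Data.Empty using (⊥-elim)
open import Data.Sum using (_⊎_; inj₁; inj₂)
open import Relation.Nullary using (yes; no; ¬_)
open import Relation.Binary.PropositionalEquality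

Point : ℕ → Set
Point = Vector ℤ

-- x occurs in L up to pointwise equality (the notion used by
-- FinitelyManySolutions, as functions are not compared extensionally).
_∈ᵖ_ : ∀ {n} → Point n → List (Point n) → Set
x ∈ᵖ L = Any (λ y → ∀ i → x i ≡ y i) L

norm : ∀ {n} → Point n → ℕ
norm {zero}  y = 0
norm {suc n} y = ∣ y fz ∣ ℕ.+ norm (λ i → y (fs i))

coordinate≤norm : ∀ {n} (y : Point n) i → ∣ y i ∣ ≤ norm y
coordinate≤norm y fz     = ℕP.m≤m+n _ _
coordinate≤norm y (fs i) =
  ℕP.≤-trans (coordinate≤norm (λ k → y (fs k)) i) (ℕP.m≤n+m _ _)

listBound : ∀ {n} → List (Point n) → ℕ
listBound []      = 0
listBound (y ∷ L) = norm y ℕ.+ listBound L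

covered⇒bounded : ∀ {n} (L : List (Point n)) (x : Point n) → x ∈ᵖ L →
                  ∀ i → ∣ x i ∣ ≤ listBound L
covered⇒bounded (y ∷ L) x (here x≗y) i rewrite x≗y i =
  ℕP.≤-trans (coordinate≤norm y i) (ℕP.m≤m+n _ _)
covered⇒bounded (y ∷ L) x (there x∈L) i =
  ℕP.≤-trans (covered⇒bounded L x x∈L i) (ℕP.m≤n+m _ _)

interval : ℕ → List ℤ
interval B = map +_ (upTo (suc B)) ++ map -[1+_] (upTo B)

∈-interval : ∀ B z → ∣ z ∣ ≤ B → z ∈ interval B
∈-interval B (+ k)      k≤B  = ∈-++⁺ˡ (∈-map⁺ +_ (∈-upTo⁺ (s≤s k≤B)))
∈-interval B -[1+ k ]   k<B  = ∈-++⁺ʳ _ (∈-map⁺ -[1+_] (∈-upTo⁺ k<B))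

box : ℕ → (n : ℕ) → List (Point n)
box B zero    = (λ ()) ∷ []
box B (suc n) = cartesianProductWith _◂_ (interval B) (box B n)

bounded⇒inBox : ∀ B n (y : Point n) → (∀ i → ∣ y i ∣ ≤ B) → y ∈ᵖ box B n
bounded⇒inBox B zero    y _   = here (λ ())
bounded⇒inBox B (suc n) y y≤B =
  let v , v∈box , tail≗v = find (bounded⇒inBox B n (λ i → y (fs i)) (λ i → y≤B (fs i)))
      head∈ = ∈-interval B (y fz) (y≤B fz)
  in lose (∈-cartesianProductWith⁺ _◂_ head∈ v∈box)
          (λ { fz → refl ; (fs i) → tail≗v i })

-- y is a relational image of x: it satisfies every additive and
-- multiplicative relation among the coordinates of x.  This is exactly the
-- second component of Λ.
Preserves : ∀ {n} → Point n → Point n → Set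
Preserves {n} x y =
    (∀ (i j k : Fin n) → x i ℤ.+ x j ≡ x k → y i ℤ.+ y j ≡ y k)
  × (∀ (i j k : Fin n) → x i ℤ.* x j ≡ x k → y i ℤ.* y j ≡ y k)

preserves-relabel : ∀ {n} (π ρ : Fin n → Fin n) → (∀ k → π (ρ k) ≡ k) →
  ∀ {x y : Point n} → Preserves (λ k → x (π k)) y → Preserves x (λ k → y (ρ k))
preserves-relabel π ρ πρ {x} (addP , mulP) =
    (λ i j k e → addP (ρ i) (ρ j) (ρ k) (transport ℤ._+_ i j k e))
  , (λ i j k e → mulP (ρ i) (ρ j) (ρ k) (transport ℤ._*_ i j k e))
  where
  x∘π∘ρ : ∀ k → x (π (ρ k)) ≡ x k
  x∘π∘ρ k = cong x (πρ k)
  transport : ∀ (_∙_ : ℤ → ℤ → ℤ) i j k → x i ∙ x j ≡ x k →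
              x (π (ρ i)) ∙ x (π (ρ j)) ≡ x (π (ρ k))
  transport _∙_ i j k e =
    trans (cong₂ _∙_ (x∘π∘ρ i) (x∘π∘ρ j)) (trans e (sym (x∘π∘ρ k)))

-- A relational image with a nonzero coordinate y_j also keeps the ones:
-- x_i = 1 gives x_i · x_j = x_j, so y_i · y_j = y_j, and y_j cancels.
preserves-holds : ∀ {n} {x y : Point n} → Preserves x y → (j : Fin n) →
  ¬ (y j ≡ + 0) → ∀ e → Holds x e → Holds y e
preserves-holds {x = x} {y} (_ , mulP) j yj≢0 (Equation.one i) xi≡1 =
  ℤP.*-cancelʳ-≡ (y i) (+ 1) (y j) {{ℤ.≢-nonZero yj≢0}}
    (trans (mulP i j j xixj≡xj) (sym (ℤP.*-identityˡ (y j))))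
  where
  xixj≡xj : x i ℤ.* x j ≡ x j
  xixj≡xj = trans (cong (ℤ._* x j) xi≡1) (ℤP.*-identityˡ (x j))
preserves-holds (addP , _) _ _ (Equation.add i j k) e = addP i j k e
preserves-holds (_ , mulP) _ _ (Equation.mul i j k) e = mulP i j k e

nonzero : ∀ {z} (N : ℕ) → N < ∣ z ∣ → ¬ (z ≡ + 0)
nonzero N N<∣z∣ refl = ℕP.<⇒≱ N<∣z∣ ℕ.z≤n

-- Λ_m moves any chosen coordinate, not only the first one: conjugate by
-- the transposition of 0 and i.
Λ-at : ∀ {m} → Λ m → (x : Point (suc m)) (i : Fin (suc m)) →
  Σ (Point (suc m)) λ y →
    (bound m < ∣ x i ∣ → Σ (Fin (suc m)) λ j → ∣ x i ∣ < ∣ y j ∣) × Preserves x y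
Λ-at Λm x i =
  let y , grows , preserves = Λm (λ k → x (transpose fz i k))
  in (λ k → y (transpose i fz k))
   , (λ big → let j , lt = grows big
              in transpose fz i j , subst (λ l → ∣ x i ∣ < ∣ y l ∣)
                                          (sym (transpose-inverse i fz)) lt)
   , preserves-relabel (transpose fz i) (transpose i fz)
       (λ _ → transpose-inverse fz i) preserves

module _ (Λs : Statement2) {m : ℕ} (S : System (suc m)) where

  largerSolution : (x : Point (suc m)) → Solution S x → (i : Fin (suc m)) →
    bound m < ∣ x i ∣ →
    Σ (Point (suc m)) λ y → Solution S y × Σ (Fin (suc m)) λ j → ∣ x i ∣ < ∣ y j ∣
  largerSolution x sol i big =
    let y , grows , preserves = Λ-at (Λs m) x i
        j , lt = grows big
    in y , (λ e e∈S → preserves-holds preserves j (nonzero _ lt) e (sol e e∈S)) , j , lt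

  unboundedSolutions : (x : Point (suc m)) → Solution S x → (i : Fin (suc m)) →
    bound m < ∣ x i ∣ → ∀ N →
    Σ (Point (suc m)) λ y → Solution S y × Σ (Fin (suc m)) λ j → N ℕ.+ bound m < ∣ y j ∣
  unboundedSolutions x sol i big zero = x , sol , i , big
  unboundedSolutions x sol i big (suc N) =
    let y , ysol , j , N+b<y = unboundedSolutions x sol i big N
        b<y = ℕP.<-≤-trans (s≤s (ℕP.m≤n+m (bound m) N)) N+b<y
        z , zsol , k , y<z = largerSolution y ysol j b<y
    in z , zsol , k , ℕP.≤-<-trans N+b<y y<z

two⇒one : Statement2 → Statement1
two⇒one Λs m S (L , covers) x sol i with bound m ℕP.<? ∣ x i ∣
... | no small = ℕP.≮⇒≥ small
... | yes big =
  let y , ysol , j , B+b<y = unboundedSolutions Λs S x sol i big (listBound L)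
      B<y = ℕP.≤-<-trans (ℕP.m≤m+n (listBound L) (bound m)) B+b<y
  in ⊥-elim (ℕP.<⇒≱ B<y (covered⇒bounded L y (covers y ysol) j))

equationsOf : ∀ {n} → Point n → System n
equationsOf x e = Holds x e

solution⇒preserves : ∀ {n} {x y : Point n} → Solution (equationsOf x) y → Preserves x y
solution⇒preserves sol =
  (λ i j k e → sol (Equation.add i j k) e) , (λ i j k e → sol (Equation.mul i j k) e)

-- Deciding which case holds is
-- the one place where excluded middle is needed.
boundedOrLarger : ExcludedMiddle 0ℓ → ∀ {n} (S : System n) (B : ℕ) →
  (Σ (Point n) λ y → Solution S y × Σ (Fin n) λ j → B < ∣ y j ∣)
  ⊎ FinitelyManySolutions S
boundedOrLarger lem {n} S B
  with lem {Σ (Point n) λ y → Solution S y × Σ (Fin n) λ j → B < ∣ y j ∣}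
... | yes larger = inj₁ larger
... | no noLarger = inj₂ (box B n , λ y sol → bounded⇒inBox B n y (inside y sol))
  where
  inside : ∀ y → Solution S y → ∀ j → ∣ y j ∣ ≤ B
  inside y sol j with ∣ y j ∣ ℕP.≤? B
  ... | yes y≤B = y≤B
  ... | no y≰B = ⊥-elim (noLarger (y , sol , j , ℕP.≰⇒> y≰B))

one⇒two : ExcludedMiddle 0ℓ → Statement1 → Statement2
one⇒two lem st1 m x with bound m ℕP.<? ∣ x fz ∣
... | no small = x , (λ big → ⊥-elim (small big)) , (λ _ _ _ e → e) , (λ _ _ _ e → e)
... | yes big with boundedOrLarger lem (equationsOf x) ∣ x fz ∣
...   | inj₁ (y , sol , j , lt) = y , (λ _ → j , lt) , solution⇒preserves sol
...   | inj₂ finite =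
  ⊥-elim (ℕP.<⇒≱ big (st1 m (equationsOf x) finite x (λ _ holds → holds) fz))

mainTheorem6 : ExcludedMiddle 0ℓ → (Statement1 → Statement2) × (Statement2 → Statement1)
mainTheorem6 lem = one⇒two lem , two⇒one
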